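{- Let $S$ be a tree on $n$ nodes and $r_1,r_2\in V(S)$. There is a sequence of at most $n-1$ rotations that transforms $S^{r_1}$ into $S^{r_2}$, such that all intermediate trees are $1$-cut trees.
   Context: A search tree on an unrooted tree $S$ (STT) is a rooted tree $T$ with $V(T)=V(S)$ defined recursively: the root $r$ is any node of $S$, and the subtrees of $T$ rooted at the children of $r$ are search trees on the connected components of $S\setminus r$. For $r\in V(S)$, $S^r$ is the STT obtained by rooting $S$ at $r$ (same edges as $S$). A rotation at a node $x$ with parent $p$: $x$ and $p$ swap places; if $x$ has a child $y$ whose subtree contains a node adjacent to $p$ in $S$, then $y$ becomes a child of $p$; all other children keep their parents. For $A\subseteq V(S)$, $\delta_S(A)$ is the set of nodes outside $A$ adjacent in $S$ to some node of $A$; an STT $T$ is a $k$-cut tree if $|\delta_S(V(T_x))|\le k$ for every $x$, where $T_x$ is the subtree of $T$ rooted at $x$. -}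

module Defs where

open import Data.Nat using (ℕ; zero; suc; _≤_)
open import Data.Fin using (Fin)
open import Data.Maybe using (Maybe; just; nothing)
open import Data.Product using (Σ; ∃; _×_; _,_)
open import Data.Sum using (_⊎_)
open import Data.Unit using (⊤)
open import Data.List using (List; []; _∷_; length)
open import Data.List.Membership.Propositional using (_∈_)
open import Data.List.Relation.Unary.Unique.Propositional using (Unique)
open import Relation.Binary.PropositionalEquality using (_≡_; _≢_)
open import Relation.Nullary using (¬_)

Graph : ℕ → Set₁
Graph n = Fin n → Fin n → Set

data Reach {n : ℕ} (E : Graph n) (B : Fin n → Set) (x : Fin n) : Fin n → Set where
  here : B x → Reach E B x x
  step : ∀ {y z} → Reach E B x y → E y z → B z → Reach E B x z

Chain : {n : ℕ} → Graph n → List (Fin n) → Set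
Chain E [] = ⊤
Chain E (x ∷ []) = ⊤
Chain E (x ∷ y ∷ r) = E x y × Chain E (y ∷ r)

lastOf : {n : ℕ} → Fin n → List (Fin n) → Fin n
lastOf z [] = z
lastOf z (w ∷ ws) = lastOf w ws

HasCycle : {n : ℕ} → Graph n → Set
HasCycle {n} E = Σ (Fin n) λ x → Σ (Fin n) λ y → Σ (Fin n) λ z → Σ (List (Fin n)) λ rest →
  Unique (x ∷ y ∷ z ∷ rest) × Chain E (x ∷ y ∷ z ∷ rest) × E (lastOf z rest) x

record IsTree {n : ℕ} (E : Graph n) : Set where
  field
    symm      : ∀ x y → E x y → E y x
    irrefl    : ∀ x → ¬ E x x
    connected : ∀ x y → Reach E (λ _ → ⊤) x y
    acyclic   : ¬ HasCycle E

-- Rooted trees on Fin n are given by a parent function (nothing = root).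
Par : ℕ → Set
Par n = Fin n → Maybe (Fin n)

-- Desc P y x : y lies in the subtree of P rooted at x.
data Desc {n : ℕ} (P : Par n) : Fin n → Fin n → Set where
  here : ∀ {x} → Desc P x x
  up   : ∀ {x y z} → P y ≡ just z → Desc P z x → Desc P y x

Subtree : {n : ℕ} → Par n → Fin n → Fin n → Set
Subtree P x y = Desc P y x

_∖_ : {n : ℕ} → (Fin n → Set) → Fin n → Fin n → Set
(C ∖ r) y = C y × y ≢ r

-- B is a connected component of the subgraph of E induced by A (B assumed nonempty separately)
IsComponent : {n : ℕ} → Graph n → (A B : Fin n → Set) → Set
IsComponent E A B =
  (∀ y → B y → A y) ×
  (∀ x y → B x → B y → Reach E B x y) ×
  (∀ x y → B x → A y → E x y → B y)

-- IsSTTOn E P C r : the subtree of P rooted at r is a search tree on the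
-- connected vertex set C of S, following the recursive definition: its vertex set
-- is C, its root r is in C, and the subtrees rooted at the children of r are
-- search trees on the connected components of C \ r.
data IsSTTOn {n : ℕ} (E : Graph n) (P : Par n) : (Fin n → Set) → Fin n → Set₁ where
  stt : ∀ {C r} → C r
      → (∀ y → Desc P y r → C y)
      → (∀ y → C y → Desc P y r)
      → (∀ c → P c ≡ just r → IsComponent E (C ∖ r) (Subtree P c) × IsSTTOn E P (Subtree P c) c)
      → IsSTTOn E P C r

IsSTT : {n : ℕ} → Graph n → Par n → Set₁
IsSTT {n} E P = Σ (Fin n) λ r → P r ≡ nothing × IsSTTOn E P (λ _ → ⊤) r

Rooting : {n : ℕ} → Graph n → Fin n → Par n → Set
Rooting E r P =
  P r ≡ nothing × (∀ y → Desc P y r) ×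
  (∀ x y → (E x y → (P x ≡ just y ⊎ P y ≡ just x)) × ((P x ≡ just y ⊎ P y ≡ just x) → E x y))

Boundary : {n : ℕ} → Graph n → (Fin n → Set) → Fin n → Set
Boundary {n} E A u = ¬ A u × Σ (Fin n) λ a → A a × E a u

AtMost : {n : ℕ} → ℕ → (Fin n → Set) → Set
AtMost {n} k A = Σ (List (Fin n)) λ xs → length xs ≤ k × (∀ u → A u → u ∈ xs)

KCut : {n : ℕ} → ℕ → Graph n → Par n → Set₁
KCut k E P = IsSTT E P × (∀ x → AtMost k (Boundary E (Subtree P x)))

Rotation : {n : ℕ} → Graph n → Par n → Fin n → Par n → Set
Rotation {n} E P x Q = Σ (Fin n) λ p →
  P x ≡ just p ×
  Q x ≡ P p ×
  Q p ≡ just x ×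
  (∀ y → P y ≡ just x →
     ((Σ (Fin n) λ z → Desc P z y × E z p) → Q y ≡ just p) ×
     (¬ (Σ (Fin n) λ z → Desc P z y × E z p) → Q y ≡ just x)) ×
  (∀ w → w ≢ x → w ≢ p → P w ≢ just x → Q w ≡ P w)

-- RotSeq E P R m : a sequence of m rotations transforming P into R (up to pointwise
-- equality of parent functions), every tree after a rotation being a 1-cut tree.
data RotSeq {n : ℕ} (E : Graph n) : Par n → Par n → ℕ → Set₁ where
  done : ∀ {P R} → (∀ v → P v ≡ R v) → RotSeq E P R zero
  step : ∀ {P Q R m} (x : Fin n) → Rotation E P x Q → KCut 1 E Q → RotSeq E Q R m
       → RotSeq E P R (suc m)

-- Every rooting S^r is a 1-cut tree: the only boundary vertex of a subtree T_x is the parent of x.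
-- Rotating the child c of the root that lies on the path towards r₂ turns S^r into S^c, and the
-- depth of r₂ drops by one; so depth r₂ < n such rotations lead from S^r₁ to S^r₂.
module Submission where

open import Defs
open import Data.Nat using (ℕ; zero; suc; _≤_; _<_; _∸_; _+_; z≤n; s≤s)
open import Data.Nat.Properties
  using (+-suc; +-identityʳ; m+1+n≢n; ∸-+-assoc; m∸[m∸n]≡n; ≤-pred; <⇒≱; m≤n+m)
open import Data.Nat.GeneralisedArithmetic using (iterate)
open import Data.Fin using (Fin; toℕ; _≟_)
open import Data.Fin.Properties using (toℕ-injective; toℕ<n; injective⇒≤)
open import Data.Maybe using (just; nothing; fromMaybe)
open import Data.Maybe.Properties using (just-injective)
open import Data.Product using (Σ; _×_; _,_; proj₁; proj₂)
open import Data.Sum using (_⊎_; inj₁; inj₂; swap)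
open import Data.Unit using (⊤; tt)
open import Data.List using ([]; _∷_)
open import Data.List.Relation.Unary.Any using (here)
open import Relation.Binary.PropositionalEquality
open import Relation.Nullary using (¬_; Dec; yes; no; contradiction)

private
  variable
    n : ℕ
    E : Graph n
    P P′ : Par n
    B : Fin n → Set
    x y z r c : Fin n

Reach-∷ : E x y → B x → Reach E B y z → Reach E B x z
Reach-∷ e bx (here by) = step (here bx) e by
Reach-∷ e bx (step ρ e′ bz) = step (Reach-∷ e bx ρ) e′ bz

Reach-++ : Reach E B x y → Reach E B y z → Reach E B x z
Reach-++ ρ (here _) = ρ
Reach-++ ρ (step σ e bz) = step (Reach-++ ρ σ) e bz

steps : Desc P y x → ℕ
steps here = 0
steps (up _ d) = suc (steps d)

Desc-trans : Desc P z y → Desc P y x → Desc P z x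
Desc-trans here e = e
Desc-trans (up p d) e = up p (Desc-trans d e)

steps-trans : (d : Desc P z y) (e : Desc P y x) → steps (Desc-trans d e) ≡ steps d + steps e
steps-trans here e = refl
steps-trans (up p d) e = cong suc (steps-trans d e)

Desc-splitFirst : ∀ {k} (d : Desc P y x) → steps d ≡ suc k →
                  Σ (Fin n) λ c → P c ≡ just x × Σ (Desc P y c) λ d′ → steps d′ ≡ k
Desc-splitFirst (up p here) refl = _ , p , here , refl
Desc-splitFirst (up p d@(up _ _)) refl with Desc-splitFirst d refl
... | c , pc , d′ , eq = c , pc , up p d′ , cong suc eq

Desc-map : (∀ {w v} → P w ≡ just v → Desc P v x → P′ w ≡ just v) → Desc P y x → Desc P′ y x
Desc-map keep here = here
Desc-map keep (up p d) = up (keep p d) (Desc-map keep d)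

steps-map : (keep : ∀ {w v} → P w ≡ just v → Desc P v x → P′ w ≡ just v) (d : Desc P y x) →
            steps (Desc-map {P′ = P′} keep d) ≡ steps d
steps-map keep here = refl
steps-map keep (up p d) = cong suc (steps-map keep d)

Linked : Par n → Fin n → Fin n → Set
Linked P x y = P x ≡ just y ⊎ P y ≡ just x

module Rooted {E : Graph n} {r : Fin n} {P : Par n} (RT : Rooting E r P) where

  root-orphan : P r ≡ nothing
  root-orphan = proj₁ RT

  below-root : ∀ y → Desc P y r
  below-root = proj₁ (proj₂ RT)

  adjacent⇒linked : ∀ x y → E x y → Linked P x y
  adjacent⇒linked x y = proj₁ (proj₂ (proj₂ RT) x y)

  linked⇒adjacent : ∀ x y → Linked P x y → E x y
  linked⇒adjacent x y = proj₂ (proj₂ (proj₂ RT) x y)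

  adjacent-sym : ∀ x y → E x y → E y x
  adjacent-sym x y e = linked⇒adjacent y x (swap (adjacent⇒linked x y e))

  child≢root : P y ≡ just z → y ≢ r
  child≢root p refl = contradiction (trans (sym root-orphan) p) λ ()

  depth : Fin n → ℕ
  depth y = steps (below-root y)

  steps-unique : (d₁ d₂ : Desc P y r) → steps d₁ ≡ steps d₂
  steps-unique here here = refl
  steps-unique here (up p _) = contradiction (trans (sym root-orphan) p) λ ()
  steps-unique (up p _) here = contradiction (trans (sym root-orphan) p) λ ()
  steps-unique (up p₁ d₁) (up p₂ d₂) with just-injective (trans (sym p₁) p₂)
  ... | refl = cong suc (steps-unique d₁ d₂)

  depth-Desc : (d : Desc P y x) → depth y ≡ steps d + depth x
  depth-Desc {y} {x} d =
    trans (steps-unique (below-root y) (Desc-trans d (below-root x))) (steps-trans d (below-root x))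

  depth-child : P y ≡ just z → depth y ≡ suc (depth z)
  depth-child p = depth-Desc (up p here)

  Desc-acyclic : Desc P y x → P x ≢ just y
  Desc-acyclic {y} {x} d p = m+1+n≢n (steps d) (sym (begin
    depth y                   ≡⟨ depth-Desc d ⟩
    steps d + depth x         ≡⟨ cong (steps d +_) (depth-child p) ⟩
    steps d + suc (depth y)   ∎))
    where open ≡-Reasoning

  depth-orphan : P y ≡ nothing → depth y ≡ 0
  depth-orphan {y} Py with below-root y
  ... | here = refl
  ... | up p _ = contradiction (trans (sym Py) p) λ ()

  parent : Fin n → Fin n
  parent y = fromMaybe y (P y)

  depth-parent : ∀ y → depth (parent y) ≡ depth y ∸ 1
  depth-parent y with P y in eq
  ... | just z = cong (_∸ 1) (sym (depth-child eq))
  ... | nothing = trans (depth-orphan eq) (cong (_∸ 1) (sym (depth-orphan eq)))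

  depth-ancestor : ∀ m y → depth (iterate parent y m) ≡ depth y ∸ m
  depth-ancestor zero y = refl
  depth-ancestor (suc m) y = begin
    depth (iterate parent (parent y) m)   ≡⟨ depth-ancestor m (parent y) ⟩
    depth (parent y) ∸ m                  ≡⟨ cong (_∸ m) (depth-parent y) ⟩
    depth y ∸ 1 ∸ m                       ≡⟨ ∸-+-assoc (depth y) 1 m ⟩
    depth y ∸ suc m                       ∎
    where open ≡-Reasoning

  -- The ancestors of y at depths 0, …, depth y are pairwise distinct.
  depth<n : ∀ y → depth y < n
  depth<n y = injective⇒≤ {f = ancestorAt} ancestorAt-injective
    where
      ancestorAt : Fin (suc (depth y)) → Fin n
      ancestorAt j = iterate parent y (depth y ∸ toℕ j)

      depth-ancestorAt : ∀ j → depth (ancestorAt j) ≡ toℕ j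
      depth-ancestorAt j =
        trans (depth-ancestor (depth y ∸ toℕ j) y) (m∸[m∸n]≡n (≤-pred (toℕ<n j)))

      ancestorAt-injective : ∀ {i j} → ancestorAt i ≡ ancestorAt j → i ≡ j
      ancestorAt-injective {i} {j} eq =
        toℕ-injective (trans (sym (depth-ancestorAt i)) (trans (cong depth eq) (depth-ancestorAt j)))

  Subtree-adjacent : ∀ {a u} → Subtree P x a → E a u → Subtree P x u ⊎ P x ≡ just u
  Subtree-adjacent {a = a} {u} da e with adjacent⇒linked a u e
  ... | inj₂ Pu = inj₁ (up Pu da)
  ... | inj₁ Pa with da
  ...   | here = inj₂ Pa
  ...   | up p d with just-injective (trans (sym p) Pa)
  ...     | refl = inj₁ d

  boundary⇒parent : ∀ {u} → Boundary E (Subtree P x) u → P x ≡ just u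
  boundary⇒parent (u∉ , a , da , e) with Subtree-adjacent da e
  ... | inj₁ du = contradiction du u∉
  ... | inj₂ Px = Px

  boundary-atMost-1 : ∀ x → AtMost 1 (Boundary E (Subtree P x))
  boundary-atMost-1 x with P x in Px
  ... | just p = p ∷ [] , s≤s z≤n , λ u b → here (just-injective (trans (sym (boundary⇒parent b)) Px))
  ... | nothing = [] , z≤n , λ u b → contradiction (trans (sym Px) (boundary⇒parent b)) λ ()

  Desc⇒Reach-up : Desc P y c → Reach E (Subtree P c) y c
  Desc⇒Reach-up here = here here
  Desc⇒Reach-up {y} (up {z = z} p d) =
    Reach-∷ (linked⇒adjacent y z (inj₁ p)) (up p d) (Desc⇒Reach-up d)

  Desc⇒Reach-down : Desc P y c → Reach E (Subtree P c) c y
  Desc⇒Reach-down here = here here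
  Desc⇒Reach-down {y} (up {z = z} p d) =
    step (Desc⇒Reach-down d) (linked⇒adjacent z y (inj₂ p)) (up p d)

  child-subtree-isComponent : (C : Fin n → Set) → (∀ y → Desc P y x → C y) → P c ≡ just x →
                              IsComponent E (C ∖ x) (Subtree P c)
  child-subtree-isComponent {x} {c} C below⇒C Pc = inside , connected , closed
    where
      inside : ∀ y → Subtree P c y → (C ∖ x) y
      inside y d = below⇒C y (Desc-trans d (up Pc here)) , λ { refl → Desc-acyclic d Pc }

      connected : ∀ y z → Subtree P c y → Subtree P c z → Reach E (Subtree P c) y z
      connected y z dy dz = Reach-++ (Desc⇒Reach-up dy) (Desc⇒Reach-down dz)

      closed : ∀ y z → Subtree P c y → (C ∖ x) z → E y z → Subtree P c z
      closed y z dy (_ , z≢x) e with Subtree-adjacent dy e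
      ... | inj₁ dz = dz
      ... | inj₂ Pc′ = contradiction (just-injective (trans (sym Pc′) Pc)) z≢x

  -- The fuel k bounds the height of the subtree at x, since depths are below n.
  isSTTOn : ∀ k x (C : Fin n → Set) → (∀ y → C y → Desc P y x) → (∀ y → Desc P y x → C y) →
            n ≤ depth x + k → IsSTTOn E P C x
  isSTTOn zero x C C⇒below below⇒C n≤ =
    contradiction (subst (n ≤_) (+-identityʳ _) n≤) (<⇒≱ (depth<n x))
  isSTTOn (suc k) x C C⇒below below⇒C n≤ =
    stt (below⇒C x here) below⇒C C⇒below λ c Pc →
      child-subtree-isComponent C below⇒C Pc ,
      isSTTOn k c (Subtree P c) (λ _ d → d) (λ _ d → d)
        (subst (λ t → n ≤ t + k) (sym (depth-child Pc)) (subst (n ≤_) (+-suc (depth x) k) n≤))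

  isKCut1 : KCut 1 E P
  isKCut1 =
    (r , root-orphan ,
     isSTTOn n r (λ _ → ⊤) (λ y _ → below-root y) (λ _ _ → tt) (m≤n+m n (depth r))) ,
    boundary-atMost-1

  rooting-unique : ∀ {P′} → Rooting E r P′ → ∀ v → P v ≡ P′ v
  rooting-unique {P′} RT′ v = agree (below-root v)
    where
      agree : ∀ {v} → Desc P v r → P v ≡ P′ v
      agree here = trans root-orphan (sym (proj₁ RT′))
      agree {v} (up {z = z} p d) with proj₁ (proj₂ (proj₂ RT′) v z) (linked⇒adjacent v z (inj₁ p))
      ... | inj₁ p′ = trans p (sym p′)
      ... | inj₂ p′ = contradiction (trans (agree d) p′) (Desc-acyclic (up p here))

module Reroot {E : Graph n} {r : Fin n} {P : Par n} (RT : Rooting E r P)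
              {c : Fin n} (Pc : P c ≡ just r) where

  open Rooted RT

  Q : Par n
  Q w with w ≟ c | w ≟ r
  ... | yes _ | _     = nothing
  ... | no _  | yes _ = just c
  ... | no _  | no _  = P w

  Q-c : Q c ≡ nothing
  Q-c with c ≟ c
  ... | yes _ = refl
  ... | no c≢c = contradiction refl c≢c

  Q-r : Q r ≡ just c
  Q-r with r ≟ c | r ≟ r
  ... | yes refl | _ = contradiction refl (child≢root Pc)
  ... | no _ | yes _ = refl
  ... | no _ | no r≢r = contradiction refl r≢r

  Q-other : ∀ {w} → w ≢ c → w ≢ r → Q w ≡ P w
  Q-other {w} w≢c w≢r with w ≟ c | w ≟ r
  ... | yes w≡c | _ = contradiction w≡c w≢c
  ... | no _ | yes w≡r = contradiction w≡r w≢r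
  ... | no _ | no _ = refl

  Q-child : P y ≡ just z → y ≢ c → Q y ≡ just z
  Q-child p y≢c = trans (Q-other y≢c (child≢root p)) p

  Desc⇒Desc-Q : Desc P y r → Desc Q y c
  Desc⇒Desc-Q here = up Q-r here
  Desc⇒Desc-Q {y} (up p d) with y ≟ c
  ... | yes refl = here
  ... | no y≢c = up (Q-child p y≢c) (Desc⇒Desc-Q d)

  parent⇒linked-Q : ∀ x y → P x ≡ just y → Linked Q x y
  parent⇒linked-Q x y = by-cases (x ≟ c)
    where
      by-cases : ∀ {x y} → Dec (x ≡ c) → P x ≡ just y → Linked Q x y
      by-cases (yes refl) p with refl ← just-injective (trans (sym Pc) p) = inj₂ Q-r
      by-cases (no x≢c) p = inj₁ (Q-child p x≢c)

  parent-Q⇒adjacent : ∀ x y → Q x ≡ just y → E x y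
  parent-Q⇒adjacent x y = by-cases (x ≟ c) (x ≟ r)
    where
      by-cases : ∀ {x y} → Dec (x ≡ c) → Dec (x ≡ r) → Q x ≡ just y → E x y
      by-cases (yes refl) _ q = contradiction (trans (sym Q-c) q) λ ()
      by-cases (no _) (yes refl) q with refl ← just-injective (trans (sym Q-r) q) =
        linked⇒adjacent r c (inj₂ Pc)
      by-cases {x} {y} (no x≢c) (no x≢r) q =
        linked⇒adjacent x y (inj₁ (trans (sym (Q-other x≢c x≢r)) q))

  rooting-Q : Rooting E c Q
  rooting-Q = Q-c , (λ y → Desc⇒Desc-Q (below-root y)) , λ x y →
    (λ e → linked-Q (adjacent⇒linked x y e)) ,
    λ { (inj₁ q) → parent-Q⇒adjacent x y q
      ; (inj₂ q) → adjacent-sym y x (parent-Q⇒adjacent y x q) }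
    where
      linked-Q : ∀ {x y} → Linked P x y → Linked Q x y
      linked-Q {x} {y} (inj₁ p) = parent⇒linked-Q x y p
      linked-Q {x} {y} (inj₂ p) = swap (parent⇒linked-Q y x p)

  -- No subtree of a child of c touches r (the neighbours of r are its children),
  -- so c keeps all its children.
  rotation-Q : Rotation E P c Q
  rotation-Q = r , Pc , trans Q-c (sym root-orphan) , Q-r ,
    (λ y Py → (λ { (z , dz , e) → contradiction e (¬grandchild-adjacent Py dz) }) ,
              (λ _ → Q-child Py λ { refl → Desc-acyclic here Py })) ,
    (λ w w≢c w≢r _ → Q-other w≢c w≢r)
    where
      ¬grandchild-adjacent : P y ≡ just c → Desc P z y → ¬ E z r
      ¬grandchild-adjacent {y} {z} Py dz e with adjacent⇒linked z r e
      ... | inj₂ Pr = contradiction (trans (sym root-orphan) Pr) λ ()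
      ... | inj₁ Pz = m+1+n≢n (steps dz) (sym (begin
        suc (depth r)                         ≡⟨ sym (depth-child Pz) ⟩
        depth z                               ≡⟨ depth-Desc dz ⟩
        steps dz + depth y                    ≡⟨ cong (steps dz +_) (depth-child Py) ⟩
        steps dz + suc (depth c)              ≡⟨ cong (λ t → steps dz + suc t) (depth-child Pc) ⟩
        steps dz + suc (suc (depth r))        ∎))
        where open ≡-Reasoning

  Q-agrees-below-c : ∀ {w v} → P w ≡ just v → Desc P v c → Q w ≡ just v
  Q-agrees-below-c p d = Q-child p λ { refl → Desc-acyclic d p }

m<n⇒m≤n∸1 : ∀ {m n} → m < n → m ≤ n ∸ 1
m<n⇒m≤n∸1 (s≤s m≤n) = m≤n

rerooting-sequence : ∀ {E : Graph n} {r₂ P₂} → Rooting E r₂ P₂ →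
                     ∀ k {r P} (RT : Rooting E r P) (d : Desc P r₂ r) → steps d ≡ k → RotSeq E P P₂ k
rerooting-sequence RT₂ zero RT here _ = done (Rooted.rooting-unique RT RT₂)
rerooting-sequence RT₂ (suc k) RT d eq with Desc-splitFirst d eq
... | c , Pc , d′ , eq′ =
  step c rotation-Q (Rooted.isKCut1 rooting-Q)
    (rerooting-sequence RT₂ k rooting-Q (Desc-map Q-agrees-below-c d′)
      (trans (steps-map Q-agrees-below-c d′) eq′))
  where open Reroot RT Pc

lemma8 : ∀ {n : ℕ} (E : Graph n) → IsTree E → (r₁ r₂ : Fin n) (P₁ P₂ : Par n)
         → Rooting E r₁ P₁ → Rooting E r₂ P₂
         → KCut 1 E P₁ × Σ ℕ (λ m → m ≤ n ∸ 1 × RotSeq E P₁ P₂ m)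
lemma8 E _ r₁ r₂ P₁ P₂ RT₁ RT₂ =
  isKCut1 , depth r₂ , m<n⇒m≤n∸1 (depth<n r₂) ,
  rerooting-sequence RT₂ (depth r₂) RT₁ (below-root r₂) refl
  where open Rooted RT₁
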